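{- Let $n$ be a positive integer and let $M$ be the $\binom{n}{2}\times 3\binom{n}{4}$ matrix whose rows are indexed by the edges of $K_n$ and whose columns are indexed by all $4$-cycles of $K_n$, with $M_{e,C}=1$ if the edge $e$ belongs to the cycle $C$ and $M_{e,C}=0$ otherwise. Then $M$ is a full rank matrix.
   Context: A $4$-cycle of $K_n$ is determined by its edge set; on each set of four vertices $\{a,b,c,d\}$ there are exactly three distinct $4$-cycles, namely $(a,b,c,d)$, $(a,c,b,d)$, $(a,b,d,c)$, so $K_n$ has $3\binom{n}{4}$ $4$-cycles. Full rank means the rank equals the minimum of the number of rows and the number of columns. -}

module Defs where

open import Data.Nat using (ℕ; zero; suc; _⊓_)
open import Data.Fin using (Fin; _<_; _≟_) renaming (zero to fz; suc to fs)
open import Data.Bool using (Bool; true; false; _∧_; _∨_; if_then_else_)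
open import Data.List using (List; []; _∷_)
open import Data.Bool.ListAction using (any)
open import Data.Product using (_×_; _,_; Σ; ∃)
open import Data.Rational using (ℚ; 0ℚ; 1ℚ; _+_; _*_)
open import Relation.Binary.PropositionalEquality using (_≡_)
open import Relation.Nullary.Decidable using (⌊_⌋)

sumFin : (r : ℕ) → (Fin r → ℚ) → ℚ
sumFin zero    f = 0ℚ
sumFin (suc r) f = f fz + sumFin r (λ i → f (fs i))

-- An edge of K_n: an unordered pair {i, j}, represented uniquely with i < j.
record Edge (n : ℕ) : Set where
  constructor edge
  field
    lo hi : Fin n
    lo<hi : lo < hi

-- A 4-cycle of K_n: a 4-element vertex set {a < b < c < d} together with
-- one of the three 4-cycles on it:
--   type 0 : (a,b,c,d)  edges ab, bc, cd, da
--   type 1 : (a,c,b,d)  edges ac, cb, bd, da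
--   type 2 : (a,b,d,c)  edges ab, bd, dc, ca
record Cycle4 (n : ℕ) : Set where
  constructor cycle4
  field
    a b c d : Fin n
    a<b : a < b
    b<c : b < c
    c<d : c < d
    type : Fin 3

cycleEdges : {n : ℕ} → Cycle4 n → List (Fin n × Fin n)
cycleEdges (cycle4 a b c d _ _ _ fz) =
  (a , b) ∷ (b , c) ∷ (c , d) ∷ (d , a) ∷ []
cycleEdges (cycle4 a b c d _ _ _ (fs fz)) =
  (a , c) ∷ (c , b) ∷ (b , d) ∷ (d , a) ∷ []
cycleEdges (cycle4 a b c d _ _ _ (fs (fs fz))) =
  (a , b) ∷ (b , d) ∷ (d , c) ∷ (c , a) ∷ []

sameEdge : {n : ℕ} → Fin n → Fin n → Fin n × Fin n → Bool
sameEdge x y (p , q) = (⌊ x ≟ p ⌋ ∧ ⌊ y ≟ q ⌋) ∨ (⌊ x ≟ q ⌋ ∧ ⌊ y ≟ p ⌋)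

edgeInCycle : {n : ℕ} → Edge n → Cycle4 n → Bool
edgeInCycle (edge x y _) C = any (sameEdge x y) (cycleEdges C)

incidence : (n : ℕ) → Edge n → Cycle4 n → ℚ
incidence n e C = if edgeInCycle e C then 1ℚ else 0ℚ

ColumnsIndependent : {Row Col : Set} → (M : Row → Col → ℚ) →
                     (r : ℕ) → (Fin r → Col) → Set
ColumnsIndependent {Row} M r f =
  (coef : Fin r → ℚ) →
  ((e : Row) → sumFin r (λ i → coef i * M e (f i)) ≡ 0ℚ) →
  (i : Fin r) → coef i ≡ 0ℚ

RankAtLeast : {Row Col : Set} → (M : Row → Col → ℚ) → ℕ → Set
RankAtLeast {Row} {Col} M k = Σ (Fin k → Col) (ColumnsIndependent M k)

-- A (rows × cols) matrix has full rank iff rank M = min(rows, cols);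
-- since rank ≤ min(rows, cols) always, this is rank M ≥ min(rows, cols).
FullRank : {Row Col : Set} → (rows cols : ℕ) → (M : Row → Col → ℚ) → Set
FullRank rows cols M = RankAtLeast M (rows ⊓ cols)

{-# OPTIONS --safe #-}
-- For n ≤ 3 there are no 4-cycles, and for n = 4 the three 4-cycles are independent. For n ≥ 5 it
-- suffices to find C(n,2) independent 4-cycles, by induction on n; for K₅ ten cycles are certified
-- independent by an explicit left inverse. To pass from K_N to K_{N+1}, add a vertex 0 (the old
-- vertices become 1, …, N) together with the N spokes 0x. The old cycles avoid the spokes, so the
-- incidence matrix is block triangular and it suffices that the N new cycles, namely the three cycles
-- on {0,1,2,3} and the cycles (0,1,2,x) for x ≥ 4, are independent on the spoke rows. There the
-- cycles (0,1,2,x) form an identity block on the spokes 0x with x ≥ 4, which the cycles on {0,1,2,3}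
-- avoid, and on the spokes 01, 02, 03 the cycles on {0,1,2,3} form an invertible 3 × 3 matrix.
module Submission where

open import Defs
open import Data.Nat using (ℕ; zero; suc; _≤_; _*_)
open import Data.Nat.Combinatorics using (_C_)

open import Algebra.Bundles using (CommutativeMonoid; Ring)
open import Data.Bool using (if_then_else_; _∧_; _∨_)
open import Data.Bool.ListAction using (any; or)
open import Data.Bool.Properties using (∨-identityʳ)
open import Data.Fin using (Fin; zero; suc; _<?_; _↑ˡ_; _↑ʳ_; splitAt; join)
import Data.Fin as Fin
open import Data.Fin.Patterns using (0F; 1F; 2F; 3F; 4F)
open import Data.Fin.Properties using (all?; join-splitAt)
open import Data.Integer using (+_)
open import Data.List using (map)
open import Data.List.Properties using (map-∘; map-cong)
open import Data.Nat using (_+_; z<s; s<s)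
open import Data.Nat.Combinatorics using (nC1≡n; nCk+nC[k+1]≡[n+1]C[k+1])
open import Data.Nat.Properties using (+-comm; m⊓n≤m; m≤n⇒∃[o]m+o≡n)
open import Data.Product using (_×_; _,_)
import Data.Product as Product
open import Data.Rational using (ℚ; 0ℚ; 1ℚ; ½; -½; -_; _/_)
import Data.Rational as ℚ
open import Data.Rational.Properties
  using (+-identityˡ; +-identityʳ; +-assoc; *-identityʳ; *-zeroˡ; *-zeroʳ; +-*-ring; *-1-commutativeMonoid)
  renaming (_≟_ to _≟ℚ_)
open import Data.Sum using (inj₁; inj₂)
open import Data.Vec using (Vec; []; _∷_; lookup)
open import Data.Vec.Functional using (_++_)
open import Data.Vec.Functional.Properties using (lookup-++ˡ; lookup-++ʳ)
open import Function using (_∘_; id)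
open import Relation.Binary.PropositionalEquality
  using (_≡_; refl; sym; trans; cong; cong₂; subst; module ≡-Reasoning)
open import Relation.Nullary.Decidable using (Dec; does; True; toWitness; ⌊⌋-map′; isYes≗does)
open import Algebra.Properties.Semiring.Sum (Ring.semiring +-*-ring)
  using (sum-syntax; sum-cong-≗; sum-replicate-zero; ∑-comm; *-distribˡ-sum)
open import Algebra.Properties.CommutativeSemigroup
  (CommutativeMonoid.commutativeSemigroup *-1-commutativeMonoid)
  using (x∙yz≈y∙xz)

private
  variable
    Row Row′ Col Col′ : Set
    n m r s a b : ℕ

sumFin≡∑ : ∀ r (x : Fin r → ℚ) → sumFin r x ≡ ∑[ i < r ] x i
sumFin≡∑ zero    x = refl
sumFin≡∑ (suc r) x = cong (x zero ℚ.+_) (sumFin≡∑ r (x ∘ suc))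

∑-zero : {x : Fin r → ℚ} → (∀ i → x i ≡ 0ℚ) → ∑[ i < r ] x i ≡ 0ℚ
∑-zero {r} x≡0 = trans (sum-cong-≗ x≡0) (sum-replicate-zero r)

∑-↑ : ∀ a {b} (x : Fin (a + b) → ℚ) →
      ∑[ k < a + b ] x k ≡ ∑[ i < a ] x (i ↑ˡ b) ℚ.+ ∑[ j < b ] x (a ↑ʳ j)
∑-↑ zero    x = sym (+-identityˡ _)
∑-↑ (suc a) x = trans (cong (x zero ℚ.+_) (∑-↑ a (x ∘ suc))) (sym (+-assoc (x zero) _ _))

-- Defined with does rather than ⌊_⌋ so that δ (suc i) (suc j) reduces to δ i j.
δ : Fin r → Fin r → ℚ
δ i j = if does (i Fin.≟ j) then 1ℚ else 0ℚ

∑-δ : (x : Fin r → ℚ) (i : Fin r) → ∑[ j < r ] (x j ℚ.* δ i j) ≡ x i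
∑-δ x zero = begin
  x zero ℚ.* 1ℚ ℚ.+ ∑[ j < _ ] (x (suc j) ℚ.* 0ℚ)
    ≡⟨ cong₂ ℚ._+_ (*-identityʳ (x zero)) (∑-zero (λ j → *-zeroʳ (x (suc j)))) ⟩
  x zero ℚ.+ 0ℚ
    ≡⟨ +-identityʳ (x zero) ⟩
  x zero
    ∎
  where open ≡-Reasoning
∑-δ x (suc i) = trans (cong₂ ℚ._+_ (*-zeroʳ (x zero)) (∑-δ (x ∘ suc) i)) (+-identityˡ (x (suc i)))

x+0≡0⇒x≡0 : {x y : ℚ} → y ≡ 0ℚ → x ℚ.+ y ≡ 0ℚ → x ≡ 0ℚ
x+0≡0⇒x≡0 {x} refl x+0≡0 = trans (sym (+-identityʳ x)) x+0≡0

0+y≡0⇒y≡0 : {x y : ℚ} → x ≡ 0ℚ → x ℚ.+ y ≡ 0ℚ → y ≡ 0ℚ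
0+y≡0⇒y≡0 {y = y} refl 0+y≡0 = trans (sym (+-identityˡ y)) 0+y≡0

↑-elim : ∀ a {b} (P : Fin (a + b) → Set) → (∀ i → P (i ↑ˡ b)) → (∀ j → P (a ↑ʳ j)) → ∀ k → P k
↑-elim a {b} P Pˡ Pʳ k = subst P (join-splitAt a b k) (P-join (splitAt a k))
  where
  P-join : ∀ s → P (join a b s)
  P-join (inj₁ i) = Pˡ i
  P-join (inj₂ j) = Pʳ j

fromRows : Vec (Vec ℚ s) r → Fin r → Fin s → ℚ
fromRows rows i k = lookup (lookup rows i) k

columnsIndependent-fromSubmatrix :
  {M : Row → Col → ℚ} {M′ : Row′ → Col′ → ℚ} {f : Fin r → Col} (ρ : Row → Row′) (κ : Col → Col′) →
  (∀ e c → M′ (ρ e) (κ c) ≡ M e c) → ColumnsIndependent M r f → ColumnsIndependent M′ r (κ ∘ f)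
columnsIndependent-fromSubmatrix {r = r} {f = f} ρ κ M′≡M ind coef comb≡0 =
  ind coef λ e → trans (sumFin-cong (λ i → cong (coef i ℚ.*_) (sym (M′≡M e (f i))))) (comb≡0 (ρ e))
  where
  sumFin-cong : {x y : Fin r → ℚ} → (∀ i → x i ≡ y i) → sumFin r x ≡ sumFin r y
  sumFin-cong {x} {y} x≡y = trans (sumFin≡∑ r x) (trans (sum-cong-≗ x≡y) (sym (sumFin≡∑ r y)))

columnsIndependent-identity : {M : Fin r → Col → ℚ} {f : Fin r → Col} →
  (∀ i j → M i (f j) ≡ δ i j) → ColumnsIndependent M r f
columnsIndependent-identity {r = r} {M = M} {f = f} M≡δ coef comb≡0 i = begin
  coef i                                ≡⟨ ∑-δ coef i ⟨
  ∑[ j < r ] (coef j ℚ.* δ i j)         ≡⟨ sum-cong-≗ {r} (λ j → cong (coef j ℚ.*_) (M≡δ i j)) ⟨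
  ∑[ j < r ] (coef j ℚ.* M i (f j))     ≡⟨ sumFin≡∑ r _ ⟨
  sumFin r (λ j → coef j ℚ.* M i (f j)) ≡⟨ comb≡0 i ⟩
  0ℚ                                    ∎
  where open ≡-Reasoning

IsLeftInverse : (M : Row → Col → ℚ) (f : Fin r → Col) (R : Fin s → Row) (L : Fin r → Fin s → ℚ) → Set
IsLeftInverse {r = r} {s = s} M f R L = ∀ i j → ∑[ k < s ] (L i k ℚ.* M (R k) (f j)) ≡ δ i j

isLeftInverse? : (M : Row → Col → ℚ) (f : Fin r → Col) (R : Fin s → Row) (L : Fin r → Fin s → ℚ) →
                 Dec (IsLeftInverse M f R L)
isLeftInverse? {s = s} M f R L = all? λ i → all? λ j → ∑[ k < s ] (L i k ℚ.* M (R k) (f j)) ≟ℚ δ i j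

columnsIndependent-leftInverse :
  {M : Row → Col → ℚ} {f : Fin r → Col} (R : Fin s → Row) (L : Fin r → Fin s → ℚ) →
  IsLeftInverse M f R L → ColumnsIndependent M r f
columnsIndependent-leftInverse {r = r} {s = s} {M = M} {f = f} R L LM≡I coef comb≡0 i = begin
  coef i
    ≡⟨ ∑-δ coef i ⟨
  ∑[ j < r ] (coef j ℚ.* δ i j)
    ≡⟨ sum-cong-≗ {r} (λ j → cong (coef j ℚ.*_) (LM≡I i j)) ⟨
  ∑[ j < r ] (coef j ℚ.* ∑[ k < s ] (L i k ℚ.* M (R k) (f j)))
    ≡⟨ sum-cong-≗ {r} (λ j → *-distribˡ-sum (coef j) (λ k → L i k ℚ.* M (R k) (f j))) ⟩
  ∑[ j < r ] ∑[ k < s ] (coef j ℚ.* (L i k ℚ.* M (R k) (f j)))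
    ≡⟨ ∑-comm (λ j k → coef j ℚ.* (L i k ℚ.* M (R k) (f j))) ⟩
  ∑[ k < s ] ∑[ j < r ] (coef j ℚ.* (L i k ℚ.* M (R k) (f j)))
    ≡⟨ sum-cong-≗ {s} (λ k → sum-cong-≗ {r} (λ j → x∙yz≈y∙xz (coef j) (L i k) (M (R k) (f j)))) ⟩
  ∑[ k < s ] ∑[ j < r ] (L i k ℚ.* (coef j ℚ.* M (R k) (f j)))
    ≡⟨ sum-cong-≗ {s} (λ k → *-distribˡ-sum (L i k) (λ j → coef j ℚ.* M (R k) (f j))) ⟨
  ∑[ k < s ] (L i k ℚ.* ∑[ j < r ] (coef j ℚ.* M (R k) (f j)))
    ≡⟨ ∑-zero (λ k → trans (cong (L i k ℚ.*_) (row≡0 k)) (*-zeroʳ (L i k))) ⟩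
  0ℚ
    ∎
  where
  open ≡-Reasoning
  row≡0 : ∀ k → ∑[ j < r ] (coef j ℚ.* M (R k) (f j)) ≡ 0ℚ
  row≡0 k = trans (sym (sumFin≡∑ r _)) (comb≡0 (R k))

columnsIndependent-byComputation :
  (M : Row → Col → ℚ) (f : Fin r → Col) (R : Fin s → Row) (L : Fin r → Fin s → ℚ) →
  {_ : True (isLeftInverse? M f R L)} → ColumnsIndependent M r f
columnsIndependent-byComputation M f R L {LM≡I} =
  columnsIndependent-leftInverse {M = M} {f = f} R L (toWitness LM≡I)

combination-++ :
  (M : Row → Col → ℚ) (f : Fin a → Col) (g : Fin b → Col) (coef : Fin (a + b) → ℚ) (e : Row) →
  sumFin (a + b) (λ k → coef k ℚ.* M e ((f ++ g) k))
    ≡ ∑[ i < a ] (coef (i ↑ˡ b) ℚ.* M e (f i)) ℚ.+ ∑[ j < b ] (coef (a ↑ʳ j) ℚ.* M e (g j))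
combination-++ {a = a} {b = b} M f g coef e = begin
  sumFin (a + b) (λ k → coef k ℚ.* M e ((f ++ g) k))
    ≡⟨ trans (sumFin≡∑ (a + b) _) (∑-↑ a _) ⟩
  ∑[ i < a ] (coef (i ↑ˡ b) ℚ.* M e ((f ++ g) (i ↑ˡ b)))
    ℚ.+ ∑[ j < b ] (coef (a ↑ʳ j) ℚ.* M e ((f ++ g) (a ↑ʳ j)))
    ≡⟨ cong₂ ℚ._+_ (sum-cong-≗ {a} (λ i → cong (λ c → coef (i ↑ˡ b) ℚ.* M e c) (lookup-++ˡ f g i)))
                    (sum-cong-≗ {b} (λ j → cong (λ c → coef (a ↑ʳ j) ℚ.* M e c) (lookup-++ʳ f g j))) ⟩
  ∑[ i < a ] (coef (i ↑ˡ b) ℚ.* M e (f i)) ℚ.+ ∑[ j < b ] (coef (a ↑ʳ j) ℚ.* M e (g j))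
    ∎
  where open ≡-Reasoning

columnsIndependent-++ : {M : Row → Col → ℚ} {f : Fin a → Col} {g : Fin b → Col} (ρ : Row′ → Row) →
  ColumnsIndependent (M ∘ ρ) a f → (∀ e j → M (ρ e) (g j) ≡ 0ℚ) → ColumnsIndependent M b g →
  ColumnsIndependent M (a + b) (f ++ g)
columnsIndependent-++ {Row = Row} {a = a} {b = b} {M = M} {f = f} {g = g} ρ f-ind g≡0 g-ind coef comb≡0 =
  ↑-elim a (λ k → coef k ≡ 0ℚ) coefˡ≡0 coefʳ≡0
  where
  combˡ combʳ : Row → ℚ
  combˡ e = ∑[ i < a ] (coef (i ↑ˡ b) ℚ.* M e (f i))
  combʳ e = ∑[ j < b ] (coef (a ↑ʳ j) ℚ.* M e (g j))
  combˡ+combʳ≡0 : ∀ e → combˡ e ℚ.+ combʳ e ≡ 0ℚ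
  combˡ+combʳ≡0 e = trans (sym (combination-++ M f g coef e)) (comb≡0 e)
  coefˡ≡0 : ∀ i → coef (i ↑ˡ b) ≡ 0ℚ
  coefˡ≡0 = f-ind (coef ∘ (_↑ˡ b)) λ e →
    trans (sumFin≡∑ a _) (x+0≡0⇒x≡0 (combʳ≡0 e) (combˡ+combʳ≡0 (ρ e)))
    where
    combʳ≡0 : ∀ e → combʳ (ρ e) ≡ 0ℚ
    combʳ≡0 e = ∑-zero λ j → trans (cong (coef (a ↑ʳ j) ℚ.*_) (g≡0 e j)) (*-zeroʳ (coef (a ↑ʳ j)))
  coefʳ≡0 : ∀ j → coef (a ↑ʳ j) ≡ 0ℚ
  coefʳ≡0 = g-ind (coef ∘ (a ↑ʳ_)) λ e →
    trans (sumFin≡∑ b _) (0+y≡0⇒y≡0 (combˡ≡0 e) (combˡ+combʳ≡0 e))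
    where
    combˡ≡0 : ∀ e → combˡ e ≡ 0ℚ
    combˡ≡0 e = ∑-zero λ i → trans (cong (ℚ._* M e (f i)) (coefˡ≡0 i)) (*-zeroˡ (M e (f i)))

columnsIndependent-↑ˡ : ∀ {M : Row → Col → ℚ} {m} d {f : Fin (m + d) → Col} →
  ColumnsIndependent M (m + d) f → ColumnsIndependent M m (f ∘ (_↑ˡ d))
columnsIndependent-↑ˡ {M = M} {m} d {f} ind coef comb≡0 i =
  trans (sym (lookup-++ˡ coef 0s i)) (ind (coef ++ 0s) extended-comb≡0 (i ↑ˡ d))
  where
  0s : Fin d → ℚ
  0s _ = 0ℚ
  extended-comb≡0 : ∀ e → sumFin (m + d) (λ k → (coef ++ 0s) k ℚ.* M e (f k)) ≡ 0ℚ
  extended-comb≡0 e = begin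
    sumFin (m + d) (λ k → (coef ++ 0s) k ℚ.* M e (f k))
      ≡⟨ trans (sumFin≡∑ (m + d) _) (∑-↑ m _) ⟩
    ∑[ i < m ] ((coef ++ 0s) (i ↑ˡ d) ℚ.* M e (f (i ↑ˡ d)))
      ℚ.+ ∑[ j < d ] ((coef ++ 0s) (m ↑ʳ j) ℚ.* M e (f (m ↑ʳ j)))
      ≡⟨ cong₂ ℚ._+_ (sum-cong-≗ {m} (λ i → cong (ℚ._* M e (f (i ↑ˡ d))) (lookup-++ˡ coef 0s i)))
                      (∑-zero (λ j → trans (cong (ℚ._* M e (f (m ↑ʳ j))) (lookup-++ʳ coef 0s j))
                                           (*-zeroˡ (M e (f (m ↑ʳ j)))))) ⟩
    ∑[ i < m ] (coef i ℚ.* M e (f (i ↑ˡ d))) ℚ.+ 0ℚ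
      ≡⟨ +-identityʳ _ ⟩
    ∑[ i < m ] (coef i ℚ.* M e (f (i ↑ˡ d)))
      ≡⟨ trans (sym (sumFin≡∑ m _)) (comb≡0 e) ⟩
    0ℚ
      ∎
    where open ≡-Reasoning

rankAtLeast-mono : {M : Row → Col → ℚ} {m k : ℕ} → m ≤ k → RankAtLeast M k → RankAtLeast M m
rankAtLeast-mono {M = M} m≤k (f , ind) with m≤n⇒∃[o]m+o≡n m≤k
... | d , refl = f ∘ (_↑ˡ d) , columnsIndependent-↑ˡ {M = M} d ind

rankAtLeast-zero : {M : Row → Col → ℚ} → RankAtLeast M 0
rankAtLeast-zero = (λ ()) , (λ _ _ ())

edgeOn : (x y : Fin n) {x<y : True (x <? y)} → Edge n
edgeOn x y {x<y} = edge x y (toWitness x<y)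

cycleOn : (a b c d : Fin n) {a<b : True (a <? b)} {b<c : True (b <? c)} {c<d : True (c <? d)} →
          Fin 3 → Cycle4 n
cycleOn a b c d {a<b} {b<c} {c<d} = cycle4 a b c d (toWitness a<b) (toWitness b<c) (toWitness c<d)

spoke : Fin n → Edge (suc n)
spoke x = edge zero (suc x) z<s

liftEdge : Edge n → Edge (suc n)
liftEdge (edge x y x<y) = edge (suc x) (suc y) (s<s x<y)

liftCycle : Cycle4 n → Cycle4 (suc n)
liftCycle (cycle4 a b c d a<b b<c c<d t) =
  cycle4 (suc a) (suc b) (suc c) (suc d) (s<s a<b) (s<s b<c) (s<s c<d) t

liftPair : Fin n × Fin n → Fin (suc n) × Fin (suc n)
liftPair = Product.map suc suc

cycleEdges-liftCycle : (C : Cycle4 n) → cycleEdges (liftCycle C) ≡ map liftPair (cycleEdges C)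
cycleEdges-liftCycle (cycle4 _ _ _ _ _ _ _ 0F) = refl
cycleEdges-liftCycle (cycle4 _ _ _ _ _ _ _ 1F) = refl
cycleEdges-liftCycle (cycle4 _ _ _ _ _ _ _ 2F) = refl

sameEdge-liftPair : (x y : Fin n) (pq : Fin n × Fin n) →
                    sameEdge (suc x) (suc y) (liftPair pq) ≡ sameEdge x y pq
sameEdge-liftPair x y (p , q) =
  cong₂ _∨_ (cong₂ _∧_ (⌊⌋-map′ _ _ (x Fin.≟ p)) (⌊⌋-map′ _ _ (y Fin.≟ q)))
            (cong₂ _∧_ (⌊⌋-map′ _ _ (x Fin.≟ q)) (⌊⌋-map′ _ _ (y Fin.≟ p)))

edgeInCycle-lift : (e : Edge n) (C : Cycle4 n) → edgeInCycle (liftEdge e) (liftCycle C) ≡ edgeInCycle e C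
edgeInCycle-lift (edge x y _) C = begin
  any (sameEdge (suc x) (suc y)) (cycleEdges (liftCycle C))
    ≡⟨ cong (any _) (cycleEdges-liftCycle C) ⟩
  or (map (sameEdge (suc x) (suc y)) (map liftPair (cycleEdges C)))
    ≡⟨ cong or (map-∘ (cycleEdges C)) ⟨
  or (map (sameEdge (suc x) (suc y) ∘ liftPair) (cycleEdges C))
    ≡⟨ cong or (map-cong (sameEdge-liftPair x y) (cycleEdges C)) ⟩
  any (sameEdge x y) (cycleEdges C)
    ∎
  where open ≡-Reasoning

incidence-lift : (e : Edge n) (C : Cycle4 n) → incidence (suc n) (liftEdge e) (liftCycle C) ≡ incidence n e C
incidence-lift e C = cong (if_then 1ℚ else 0ℚ) (edgeInCycle-lift e C)

incidence-spoke-liftCycle : (x : Fin n) (C : Cycle4 n) → incidence (suc n) (spoke x) (liftCycle C) ≡ 0ℚ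
incidence-spoke-liftCycle x (cycle4 _ _ _ _ _ _ _ 0F) = refl
incidence-spoke-liftCycle x (cycle4 _ _ _ _ _ _ _ 1F) = refl
incidence-spoke-liftCycle x (cycle4 _ _ _ _ _ _ _ 2F) = refl

spokeIncidence : ∀ m → Fin (3 + m) → Cycle4 (4 + m) → ℚ
spokeIncidence m x = incidence (4 + m) (spoke x)

k4Cycle : Fin 3 → Cycle4 (4 + m)
k4Cycle = cycleOn 0F 1F 2F 3F

fanCycle : Fin m → Cycle4 (4 + m)
fanCycle w = cycleOn 0F 1F 2F (4 ↑ʳ w) 0F

k4Cycle-independent : ColumnsIndependent (spokeIncidence m) 3 k4Cycle
k4Cycle-independent {m} = columnsIndependent-byComputation (spokeIncidence m) k4Cycle (_↑ˡ m) inverse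
  where
  -- the inverse of the incidence matrix [[1,0,1],[0,1,1],[1,1,0]] of the spokes 01, 02, 03
  inverse : Fin 3 → Fin 3 → ℚ
  inverse = fromRows
    ( ( ½ ∷ -½ ∷  ½ ∷ [])
    ∷ (-½ ∷  ½ ∷  ½ ∷ [])
    ∷ ( ½ ∷  ½ ∷ -½ ∷ [])
    ∷ [])

fanCycle-independent : ColumnsIndependent (spokeIncidence m ∘ (3 ↑ʳ_)) m fanCycle
fanCycle-independent {m} =
  columnsIndependent-identity {M = spokeIncidence m ∘ (3 ↑ʳ_)} {f = fanCycle} λ w w′ →
  cong (if_then 1ℚ else 0ℚ) (trans (∨-identityʳ _) (isYes≗does (4 ↑ʳ w Fin.≟ 4 ↑ʳ w′)))

spokeIncidence-k4Cycle : ∀ (w : Fin m) (t : Fin 3) → spokeIncidence m (3 ↑ʳ w) (k4Cycle t) ≡ 0ℚ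
spokeIncidence-k4Cycle w 0F = refl
spokeIncidence-k4Cycle w 1F = refl
spokeIncidence-k4Cycle w 2F = refl

newCycles : Fin (m + 3) → Cycle4 (4 + m)
newCycles {m} = fanCycle ++ k4Cycle {m}

newCycles-independent : ColumnsIndependent (spokeIncidence m) (m + 3) newCycles
newCycles-independent {m} =
  columnsIndependent-++ {M = spokeIncidence m} (3 ↑ʳ_)
    fanCycle-independent spokeIncidence-k4Cycle k4Cycle-independent

rankAtLeast-addVertex : ∀ m {k} →
  RankAtLeast (incidence (3 + m)) k → RankAtLeast (incidence (4 + m)) ((m + 3) + k)
rankAtLeast-addVertex m (f , ind) =
  newCycles ++ (liftCycle ∘ f) ,
  columnsIndependent-++ {M = incidence (4 + m)} spoke newCycles-independent
    (λ x j → incidence-spoke-liftCycle x (f j))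
    (columnsIndependent-fromSubmatrix {M′ = incidence (4 + m)} {f = f} liftEdge liftCycle incidence-lift ind)

k5-rankAtLeast : RankAtLeast (incidence 5) 10
k5-rankAtLeast = cycles , columnsIndependent-byComputation (incidence 5) cycles edges inverse
  where
  edges : Fin 10 → Edge 5
  edges = lookup
    ( edgeOn 0F 1F ∷ edgeOn 0F 2F ∷ edgeOn 0F 3F ∷ edgeOn 0F 4F ∷ edgeOn 1F 2F
    ∷ edgeOn 1F 3F ∷ edgeOn 1F 4F ∷ edgeOn 2F 3F ∷ edgeOn 2F 4F ∷ edgeOn 3F 4F ∷ [])
  cycles : Fin 10 → Cycle4 5
  cycles = lookup
    ( cycleOn 0F 1F 2F 3F 0F ∷ cycleOn 0F 1F 2F 3F 1F ∷ cycleOn 0F 1F 2F 3F 2F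
    ∷ cycleOn 0F 1F 2F 4F 0F ∷ cycleOn 0F 1F 2F 4F 1F ∷ cycleOn 0F 1F 2F 4F 2F
    ∷ cycleOn 0F 1F 3F 4F 0F ∷ cycleOn 0F 1F 3F 4F 1F
    ∷ cycleOn 0F 2F 3F 4F 0F
    ∷ cycleOn 1F 2F 3F 4F 2F ∷ [])
  ¼ -¼ : ℚ
  ¼ = + 1 / 4
  -¼ = - ¼
  inverse : Fin 10 → Fin 10 → ℚ
  inverse = fromRows
    ( (  ¼ ∷ -¼ ∷  ¼ ∷ -¼ ∷  ¼ ∷ -¼ ∷  ¼ ∷  ¼ ∷ -¼ ∷  ¼ ∷ [])
    ∷ ( 0ℚ ∷  ½ ∷  ½ ∷ 0ℚ ∷ 0ℚ ∷ 0ℚ ∷ -½ ∷ -½ ∷ 0ℚ ∷ 0ℚ ∷ [])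
    ∷ ( 0ℚ ∷ 0ℚ ∷ -½ ∷ 0ℚ ∷ 0ℚ ∷  ½ ∷ 0ℚ ∷  ½ ∷ 0ℚ ∷ -½ ∷ [])
    ∷ ( 0ℚ ∷ 0ℚ ∷ 0ℚ ∷  ½ ∷ 0ℚ ∷ 0ℚ ∷ -½ ∷ 0ℚ ∷  ½ ∷ -½ ∷ [])
    ∷ ( 0ℚ ∷ 0ℚ ∷ -½ ∷ 0ℚ ∷  ½ ∷ 0ℚ ∷  ½ ∷ 0ℚ ∷ -½ ∷ 0ℚ ∷ [])
    ∷ (  ¼ ∷  ¼ ∷  ¼ ∷ -¼ ∷ -¼ ∷ -¼ ∷  ¼ ∷ -¼ ∷  ¼ ∷  ¼ ∷ [])
    ∷ (  ½ ∷ 0ℚ ∷ 0ℚ ∷ 0ℚ ∷ 0ℚ ∷ 0ℚ ∷ 0ℚ ∷ -½ ∷ -½ ∷  ½ ∷ [])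
    ∷ ( -¼ ∷ -¼ ∷  ¼ ∷  ¼ ∷ -¼ ∷  ¼ ∷  ¼ ∷  ¼ ∷  ¼ ∷ -¼ ∷ [])
    ∷ ( -¼ ∷  ¼ ∷  ¼ ∷  ¼ ∷ -¼ ∷ -¼ ∷ -¼ ∷  ¼ ∷  ¼ ∷  ¼ ∷ [])
    ∷ ( -¼ ∷ -¼ ∷ -¼ ∷ -¼ ∷  ¼ ∷  ¼ ∷  ¼ ∷  ¼ ∷  ¼ ∷  ¼ ∷ [])
    ∷ [])

n+nC2≡[1+n]C2 : ∀ n → n + n C 2 ≡ suc n C 2
n+nC2≡[1+n]C2 n = trans (cong (_+ n C 2) (sym (nC1≡n n))) (nCk+nC[k+1]≡[n+1]C[k+1] n 1)

rankAtLeast-nC2 : ∀ k → RankAtLeast (incidence (5 + k)) ((5 + k) C 2)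
rankAtLeast-nC2 zero    = k5-rankAtLeast
rankAtLeast-nC2 (suc k) =
  subst (RankAtLeast (incidence (6 + k)))
        (trans (cong (_+ (5 + k) C 2) (+-comm (2 + k) 3)) (n+nC2≡[1+n]C2 (5 + k)))
        (rankAtLeast-addVertex (2 + k) (rankAtLeast-nC2 k))

mainTheorem2 : (n : ℕ) → 1 ≤ n →
    FullRank (n C 2) (3 * (n C 4)) (incidence n)
mainTheorem2 0 ()
mainTheorem2 1 _ = rankAtLeast-zero {M = incidence 1}
mainTheorem2 2 _ = rankAtLeast-zero {M = incidence 2}
mainTheorem2 3 _ = rankAtLeast-zero {M = incidence 3}
mainTheorem2 4 _ =
  k4Cycle ,
  columnsIndependent-fromSubmatrix {M′ = incidence 4} {f = k4Cycle} spoke id (λ _ _ → refl) k4Cycle-independent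
mainTheorem2 (suc (suc (suc (suc (suc k))))) _ =
  rankAtLeast-mono {M = incidence (5 + k)} (m⊓n≤m _ _) (rankAtLeast-nC2 k)
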